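{- Let $n\ge 6$ be even. Every pair of non-equal neighbors (extended difference rows of normal Latin rows of length $n$ with maximum inner distance) is determined. Further, a Latin square $L$ of order $n$ with inner distance $\frac n2-1$ is a row product if and only if there exist two consecutive rows of $L$ with the same difference row.
   Context: $\mathrm{dist}(a,b)$ is the minimum of the residues in $[0,n-1]$ of $a-b$ and $b-a$ mod $n$. A Latin row $(s_1,\dots,s_n)$ is a permutation of $[1,n]$; normal if $s_1=1$; of maximum inner distance if $\mathrm{dist}(s_j,s_{j+1})\ge\frac n2-1$ for $j\le n-1$. Its difference row is $(h_1,\dots,h_{n-1})$, $h_j\in[0,n-1]$, $h_j\equiv s_{j+1}-s_j$; with $h_n\in[0,n-1]$, $h_n\equiv s_1-s_n$, its extended difference row is $(\epsilon_1,\dots,\epsilon_{n-1},h)$, $\epsilon_j=h_j-\frac n2$, $h=h_n-\frac n2$ (integers). Two such extended difference rows $d_*,d_*'$ (of rows $r,r'$) are neighbors if some additions of $r$ and $r'$ (adding a constant to all entries mod $n$) stacked as two rows form a $2\times n$ Latin rectangle (no repeated symbol in any row or column) in which all horizontally or vertically adjacent symbols have distance at least $\frac n2-1$. Neighbors $d_*=(\epsilon_j)$, $d_*'=(\epsilon'_j)$ are determined if there are columns $1\le j_1<j_2\le n$ with $\left|\sum_{j=j_1}^{j_2-1}(\epsilon'_j-\epsilon_j)\right|=2$. A Latin square of order $n$ has inner distance equal to the minimum $\mathrm{dist}$ over horizontally/vertically adjacent cells. Its horizontal difference matrix $H$ is the $n\times(n-1)$ matrix with $h_{i,j}\in[0,n-1]$,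 $h_{i,j}\equiv m_{i,j+1}-m_{i,j}$; $L$ is a row product if all rows of $H$ are equal (equivalently, $m_{i,j}\equiv s+\sum_{k<i}b_k+\sum_{k<j}a_k \pmod n$ for some difference rows $(a_k),(b_k)$ and constant $s$). -}

module Defs where

open import Data.Nat as ℕ using (ℕ; zero; suc; _≤_; _<_; _∸_; _⊓_; _<ᵇ_; NonZero)
open import Data.Nat.DivMod using (_/_; _%_)
open import Data.Integer as ℤ using (ℤ; +_; _-_; ∣_∣; _%ℕ_)
open import Data.Sum using (_⊎_)
open import Data.Bool using (if_then_else_)
open import Data.Product using (Σ; ∃; _×_; _,_)
open import Relation.Binary.PropositionalEquality using (_≡_)
open import Relation.Nullary using (¬_)

-- Conventions: n is the order; rows/squares are indexed 1-based by natural
-- numbers (positions 1..n), symbols are natural numbers in [1,n].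
-- Values at positions outside [1,n] are irrelevant junk.

Row : Set
Row = ℕ → ℕ

Square : Set
Square = ℕ → ℕ → ℕ   -- L i j = entry in row i, column j

module _ (n : ℕ) .{{_ : NonZero n}} where

  res : ℕ → ℕ → ℕ
  res a b = (+ a - + b) %ℕ n

  dist : ℕ → ℕ → ℕ
  dist a b = res a b ⊓ res b a

  bound : ℕ
  bound = n / 2 ∸ 1

  InRange : ℕ → Set
  InRange j = 1 ≤ j × j ≤ n

  LatinRow : Row → Set
  LatinRow r = (∀ j → InRange j → InRange (r j))
             × (∀ i j → InRange i → InRange j → r i ≡ r j → i ≡ j)

  Normal : Row → Set
  Normal r = r 1 ≡ 1

  MaxInnerDist : Row → Set
  MaxInnerDist r = ∀ j → 1 ≤ j → j < n → bound ≤ dist (r j) (r (suc j))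

  -- normal Latin row of length n with maximum inner distance
  Admissible : Row → Set
  Admissible r = LatinRow r × Normal r × MaxInnerDist r

  nxt : ℕ → ℕ
  nxt j = if j <ᵇ n then suc j else 1

  -- extended difference row, 1-based: positions 1..n-1 give ε_j = h_j - n/2,
  -- position n gives h = h_n - n/2 with h_n ≡ s_1 - s_n
  extDiff : Row → ℕ → ℤ
  extDiff r j = + res (r (nxt j)) (r j) - + (n / 2)

  SameRow : (ℕ → ℤ) → (ℕ → ℤ) → Set
  SameRow d d' = ∀ j → InRange j → d j ≡ d' j

  -- addition of the constant c to all entries mod n (symbols kept in [1,n])
  addConst : ℕ → Row → Row
  addConst c r j = suc ((r j ℕ.+ c ∸ 1) % n)

  GoodRectangle : Row → Row → Set
  GoodRectangle a b =
      LatinRow a × LatinRow b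
    × (∀ j → InRange j → ¬ (a j ≡ b j))
    × MaxInnerDist a × MaxInnerDist b
    × (∀ j → InRange j → bound ≤ dist (a j) (b j))

  -- the extended difference rows of r and r' are neighbors
  Neighbors : Row → Row → Set
  Neighbors r r' = ∃ λ c → ∃ λ c' → GoodRectangle (addConst c r) (addConst c' r')

  sumFrom : (ℕ → ℤ) → ℕ → ℕ → ℤ
  sumFrom g a zero = + 0
  sumFrom g a (suc len) = g a ℤ.+ sumFrom g (suc a) len

  Determined : (ℕ → ℤ) → (ℕ → ℤ) → Set
  Determined d d' = ∃ λ j₁ → ∃ λ j₂ → 1 ≤ j₁ × j₁ < j₂ × j₂ ≤ n
    × ∣ sumFrom (λ j → d' j - d j) j₁ (j₂ ∸ j₁) ∣ ≡ 2

  LatinSquare : Square → Set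
  LatinSquare L = (∀ i j → InRange i → InRange j → InRange (L i j))
    × (∀ i j j' → InRange i → InRange j → InRange j' → L i j ≡ L i j' → j ≡ j')
    × (∀ i i' j → InRange i → InRange i' → InRange j → L i j ≡ L i' j → i ≡ i')

  InnerDistanceEq : Square → ℕ → Set
  InnerDistanceEq L k =
      ( (∀ i j → InRange i → 1 ≤ j → j < n → k ≤ dist (L i j) (L i (suc j)))
      × (∀ i j → 1 ≤ i → i < n → InRange j → k ≤ dist (L i j) (L (suc i) j)))
    × ( (∃ λ i → ∃ λ j → InRange i × 1 ≤ j × j < n × dist (L i j) (L i (suc j)) ≡ k)
      ⊎ (∃ λ i → ∃ λ j → 1 ≤ i × i < n × InRange j × dist (L i j) (L (suc i) j) ≡ k))

  -- horizontal difference matrix: h_{i,j} ≡ m_{i,j+1} - m_{i,j}, in [0,n-1]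
  hdiff : Square → ℕ → ℕ → ℕ
  hdiff L i j = res (L i (suc j)) (L i j)

  -- all rows of H equal
  RowProduct : Square → Set
  RowProduct L = ∀ i i' j → InRange i → InRange i' → 1 ≤ j → j < n
    → hdiff L i j ≡ hdiff L i' j

  ConsecutiveSameDiff : Square → Set
  ConsecutiveSameDiff L = ∃ λ i → 1 ≤ i × i < n
    × (∀ j → 1 ≤ j → j < n → hdiff L i j ≡ hdiff L (suc i) j)

{-# OPTIONS --safe #-}
-- Write n = 2m.  For symbols a, b at distance ≥ m - 1 the offset res (b - a) - m lies in {-1, 0, 1},
-- and an extended difference row is the row of horizontal offsets.
--
-- Stack two neighbours and let δ j be the vertical offset in column j.  Around each 2 × 2 block the
-- horizontal offsets change by δ (j + 1) - δ j, so the sums in Determined telescope to δ j₂ - δ j₁.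
-- If δ takes both values -1 and 1 the pair is determined.  Otherwise δ takes two adjacent values,
-- and then it is constant: a Latin row meets every residue class, and a column where δ is low
-- sitting one step beyond a column where δ is high would repeat an entry of the lower row.
-- Constant δ makes the two rows equal.
--
-- In a Latin square with inner distance m - 1, consecutive rows X, Y have the same difference row
-- iff Y ≡ X + t.  Such a shift passes to the next row Z: the vertical offsets of Y over X are a
-- constant c, so Z j ≡ X j + c + d j with c + d j ≠ 0 (columns are Latin).  For c = ±1 the offsets
-- d are two-valued, hence constant; for c = 0, Z ≡ X ± 1 and d only depends on the parity of the
-- entries of X, which a parity argument (separately for m odd and m even) shows to be constant.
-- Spreading from one pair of rows to all of them gives a row product.
module Submission where

open import Data.Nat using (ℕ; _≤_; _∸_; NonZero)
open import Data.Nat.DivMod using (_/_)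
open import Data.Nat.Divisibility using (_∣_; divides)
open import Data.Product using (_×_)
open import Relation.Nullary using (¬_)
open import Function.Bundles using (_⇔_; mk⇔)

open import Defs
open import Data.Bool using (true; false; T)
open import Data.Empty using (⊥; ⊥-elim)
open import Data.Fin as Fin using (Fin; toℕ; fromℕ<; punchOut)
import Data.Fin.Properties as Fin
open import Data.Integer as ℤ using (ℤ; +_; _+_; _*_; -_; _-_; ∣_∣; _⊖_; _%ℕ_; _/ℕ_; -1ℤ; 0ℤ; 1ℤ)
open import Data.Integer.DivMod using (a≡a%ℕn+[a/ℕn]*n; n%ℕd<d)
import Data.Integer.Divisibility.Signed as ℤ∣
import Data.Integer.Properties as ℤ
open import Data.Integer.Tactic.RingSolver using (solve-∀)
open import Data.Nat as ℕ using (zero; suc; z≤n; s≤s; _<_; _≤′_; ≤′-refl; ≤′-step)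
open import Data.Nat.DivMod using (m*n/n≡m)
import Data.Nat.Divisibility as ℕ∣
import Data.Nat.Properties as ℕ
open import Data.Product using (∃; _,_; proj₁; proj₂)
open import Data.Sum using (_⊎_; inj₁; inj₂; [_,_]′)
open import Data.Unit using (tt)
open import Function.Definitions using (Injective)
open import Level using (0ℓ)
open import Relation.Binary using (Setoid; tri<; tri≈; tri>)
open import Relation.Binary.PropositionalEquality
import Relation.Binary.Reasoning.Setoid
open import Relation.Nullary using (Dec; yes; no; contradiction)
import Relation.Nullary.Decidable as Dec

data Trit : ℤ → Set where
  -1ₜ : Trit -1ℤ
  0ₜ  : Trit 0ℤ
  +1ₜ : Trit 1ℤ

data Sign : ℤ → Set where
  -1ₛ : Sign -1ℤ
  +1ₛ : Sign 1ℤ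

∣trit∣≤1 : ∀ {e} → Trit e → ∣ e ∣ ≤ 1
∣trit∣≤1 -1ₜ = s≤s z≤n
∣trit∣≤1 0ₜ  = z≤n
∣trit∣≤1 +1ₜ = s≤s z≤n

sign⇒trit : ∀ {d} → Sign d → Trit d
sign⇒trit -1ₛ = -1ₜ
sign⇒trit +1ₛ = +1ₜ

sign-cases : ∀ {d} → Sign d → d ≡ -1ℤ ⊎ d ≡ 1ℤ
sign-cases -1ₛ = inj₁ refl
sign-cases +1ₛ = inj₂ refl

sign≢0 : ∀ {d} → Sign d → d ≢ 0ℤ
sign≢0 -1ₛ ()
sign≢0 +1ₛ ()

trit⇒zero⊎sign : ∀ {e} → Trit e → e ≡ 0ℤ ⊎ Sign e
trit⇒zero⊎sign -1ₜ = inj₂ -1ₛ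
trit⇒zero⊎sign 0ₜ  = inj₁ refl
trit⇒zero⊎sign +1ₜ = inj₂ +1ₛ

trit≢-1 : ∀ {x} → Trit x → x ≢ -1ℤ → x ≡ 0ℤ ⊎ x ≡ 0ℤ + 1ℤ
trit≢-1 -1ₜ x≢-1 = contradiction refl x≢-1
trit≢-1 0ₜ  _    = inj₁ refl
trit≢-1 +1ₜ _    = inj₂ refl

trit≢1 : ∀ {x} → Trit x → x ≢ 1ℤ → x ≡ -1ℤ ⊎ x ≡ -1ℤ + 1ℤ
trit≢1 -1ₜ _   = inj₁ refl
trit≢1 0ₜ  _   = inj₂ refl
trit≢1 +1ₜ x≢1 = contradiction refl x≢1

trit-⊖ : ∀ u m → m ≤ suc u → u ≤ suc m → Trit (u ⊖ m)
trit-⊖ zero          zero          _         _         = 0ₜ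
trit-⊖ zero          (suc zero)    _         _         = -1ₜ
trit-⊖ zero          (suc (suc m)) (s≤s ())  _
trit-⊖ (suc zero)    zero          _         _         = +1ₜ
trit-⊖ (suc (suc u)) zero          _         (s≤s ())
trit-⊖ (suc u)       (suc m)       (s≤s m≤u) (s≤s u≤m) =
  subst Trit (sym (ℤ.[1+m]⊖[1+n]≡m⊖n u m)) (trit-⊖ u m m≤u u≤m)

sign-≢-≢⇒≡ : ∀ {a b c} → Sign a → Sign b → Sign c → a ≢ b → b ≢ c → a ≡ c
sign-≢-≢⇒≡ -1ₛ -1ₛ _   a≢b _   = contradiction refl a≢b
sign-≢-≢⇒≡ +1ₛ +1ₛ _   a≢b _   = contradiction refl a≢b
sign-≢-≢⇒≡ -1ₛ +1ₛ -1ₛ _   _   = refl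
sign-≢-≢⇒≡ -1ₛ +1ₛ +1ₛ _   b≢c = contradiction refl b≢c
sign-≢-≢⇒≡ +1ₛ -1ₛ +1ₛ _   _   = refl
sign-≢-≢⇒≡ +1ₛ -1ₛ -1ₛ _   b≢c = contradiction refl b≢c

-- f - e = d' - d = ±2 forces e = d.
sign-jump : ∀ {e f d d'} → Trit e → Trit f → Sign d → Sign d'
          → f - e ≡ d' - d → d' ≢ d → e + e ≡ d - d'
sign-jump _   _   -1ₛ -1ₛ _  d'≢d = contradiction refl d'≢d
sign-jump _   _   +1ₛ +1ₛ _  d'≢d = contradiction refl d'≢d
sign-jump -1ₜ _   -1ₛ +1ₛ _  _    = refl
sign-jump 0ₜ  -1ₜ -1ₛ +1ₛ () _
sign-jump 0ₜ  0ₜ  -1ₛ +1ₛ () _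
sign-jump 0ₜ  +1ₜ -1ₛ +1ₛ () _
sign-jump +1ₜ -1ₜ -1ₛ +1ₛ () _
sign-jump +1ₜ 0ₜ  -1ₛ +1ₛ () _
sign-jump +1ₜ +1ₜ -1ₛ +1ₛ () _
sign-jump +1ₜ _   +1ₛ -1ₛ _  _    = refl
sign-jump 0ₜ  -1ₜ +1ₛ -1ₛ () _
sign-jump 0ₜ  0ₜ  +1ₛ -1ₛ () _
sign-jump 0ₜ  +1ₜ +1ₛ -1ₛ () _
sign-jump -1ₜ -1ₜ +1ₛ -1ₛ () _
sign-jump -1ₜ 0ₜ  +1ₛ -1ₛ () _
sign-jump -1ₜ +1ₜ +1ₛ -1ₛ () _

sign-odd : ∀ {e} → Sign e → ∃ λ k → e ≡ 1ℤ + + 2 * k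
sign-odd -1ₛ = -1ℤ , refl
sign-odd +1ₛ = 0ℤ , refl

even⊎odd : ∀ k → ∃ λ h → k ≡ 2 ℕ.* h ⊎ k ≡ 1 ℕ.+ 2 ℕ.* h
even⊎odd zero = 0 , inj₁ refl
even⊎odd (suc k) with even⊎odd k
... | h , inj₁ k≡2h   = h , inj₂ (cong suc k≡2h)
... | h , inj₂ k≡2h+1 = suc h , inj₁ (trans (cong suc k≡2h+1) (cong suc (sym (ℕ.+-suc h (h ℕ.+ 0)))))

m*2≡m+m : ∀ m → m ℕ.* 2 ≡ m ℕ.+ m
m*2≡m+m m = trans (ℕ.*-comm m 2) (cong (m ℕ.+_) (ℕ.+-identityʳ m))

x+x≡0⇒x≡0 : ∀ {x} → x + x ≡ 0ℤ → x ≡ 0ℤ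
x+x≡0⇒x≡0 {+ zero} _ = refl

injective⇒surjective : ∀ {k} {f : Fin k → Fin k} → Injective _≡_ _≡_ f → ∀ y → ∃ λ x → f x ≡ y
injective⇒surjective {suc k} {f} f-inj y with Fin.any? (λ x → f x Fin.≟ y)
... | yes hit = hit
... | no miss = contradiction (Fin.injective⇒≤ punched-injective) ℕ.1+n≰n
  where
  y≢f : ∀ x → y ≢ f x
  y≢f x y≡fx = miss (x , sym y≡fx)
  punched : Fin (suc k) → Fin k
  punched x = punchOut (y≢f x)
  punched-injective : Injective _≡_ _≡_ punched
  punched-injective eq = f-inj (Fin.punchOut-injective (y≢f _) (y≢f _) eq)

module _ {p} (P : ℕ → Set p) where

  spread-up : ∀ {i b} → (∀ k → i ≤ k → suc k < b → P k → P (suc k))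
            → P i → ∀ {k} → i ≤ k → k < b → P k
  spread-up {i} {b} step Pi i≤k = go (ℕ.≤⇒≤′ i≤k)
    where
    go : ∀ {k} → i ≤′ k → k < b → P k
    go ≤′-refl            _    = Pi
    go (≤′-step {k} i≤′k) k+1<b = step k (ℕ.≤′⇒≤ i≤′k) k+1<b (go i≤′k (ℕ.<-trans (ℕ.n<1+n k) k+1<b))

  spread-down : ∀ {a i} → (∀ k → a ≤ k → suc k ≤ i → P (suc k) → P k)
              → P i → ∀ {k} → a ≤ k → k ≤ i → P k
  spread-down {a} {i} step Pi {k} a≤k k≤i = go (ℕ.≤⇒≤′ k≤i) ℕ.≤-refl Pi
    where
    go : ∀ {j} → k ≤′ j → j ≤ i → P j → P k
    go ≤′-refl            _      Pk    = Pk
    go (≤′-step {j} k≤′j) j+1≤i Pj+1 =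
      go k≤′j (ℕ.<⇒≤ j+1≤i) (step j (ℕ.≤-trans a≤k (ℕ.≤′⇒≤ k≤′j)) j+1≤i Pj+1)

-- Congruence modulo n

module Modular (n : ℕ) .{{_ : NonZero n}} where

  infix 4 _≋_
  record _≋_ (x y : ℤ) : Set where
    constructor mod
    field n∣x-y : + n ℤ∣.∣ x - y
  open _≋_

  ≋-resp : ∀ {x y x' y'} → x - y ≡ x' - y' → x ≋ y → x' ≋ y'
  ≋-resp eq (mod n∣x-y) = mod (subst (+ n ℤ∣.∣_) eq n∣x-y)

  ≋-reflexive : ∀ {x y} → x ≡ y → x ≋ y
  ≋-reflexive x≡y = mod (ℤ∣.divides 0ℤ (ℤ.i≡j⇒i-j≡0 x≡y))

  ≋-refl : ∀ {x} → x ≋ x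
  ≋-refl = ≋-reflexive refl

  ≋-sym : ∀ {x y} → x ≋ y → y ≋ x
  ≋-sym {x} {y} (mod x≋y) = mod (subst (+ n ℤ∣.∣_) (lemma x y) (ℤ∣.∣m⇒∣-m x≋y))
    where lemma : ∀ x y → - (x - y) ≡ y - x
          lemma = solve-∀

  ≋-trans : ∀ {x y z} → x ≋ y → y ≋ z → x ≋ z
  ≋-trans {x} {y} {z} (mod x≋y) (mod y≋z) = mod (subst (+ n ℤ∣.∣_) (lemma x y z) (ℤ∣.∣m∣n⇒∣m+n x≋y y≋z))
    where lemma : ∀ x y z → (x - y) + (y - z) ≡ x - z
          lemma = solve-∀

  ≋-setoid : Setoid 0ℓ 0ℓ
  ≋-setoid = record
    { Carrier       = ℤ
    ; _≈_           = _≋_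
    ; isEquivalence = record { refl = ≋-refl ; sym = ≋-sym ; trans = ≋-trans }
    }

  module ≋-Reasoning = Relation.Binary.Reasoning.Setoid ≋-setoid

  +-cong-≋ : ∀ {a b c d} → a ≋ b → c ≋ d → a + c ≋ b + d
  +-cong-≋ {a} {b} {c} {d} (mod a≋b) (mod c≋d) = mod (subst (+ n ℤ∣.∣_) (lemma a b c d) (ℤ∣.∣m∣n⇒∣m+n a≋b c≋d))
    where lemma : ∀ a b c d → (a - b) + (c - d) ≡ (a + c) - (b + d)
          lemma = solve-∀

  -‿cong-≋ : ∀ {a b} → a ≋ b → - a ≋ - b
  -‿cong-≋ {a} {b} (mod a≋b) = mod (subst (+ n ℤ∣.∣_) (lemma a b) (ℤ∣.∣m⇒∣-m a≋b))
    where lemma : ∀ a b → - (a - b) ≡ - a - - b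
          lemma = solve-∀

  -‿cong₂-≋ : ∀ {a b c d} → a ≋ b → c ≋ d → a - c ≋ b - d
  -‿cong₂-≋ a≋b c≋d = +-cong-≋ a≋b (-‿cong-≋ c≋d)

  n≋0 : + n ≋ 0ℤ
  n≋0 = mod (ℤ∣.divides 1ℤ (lemma (+ n)))
    where lemma : ∀ x → x - 0ℤ ≡ 1ℤ * x
          lemma = solve-∀

  %ℕ-≋ : ∀ x → + (x %ℕ n) ≋ x
  %ℕ-≋ x = mod (ℤ∣.divides (- (x /ℕ n))
    (trans (cong (λ x′ → + (x %ℕ n) - x′) (a≡a%ℕn+[a/ℕn]*n x n)) (lemma (+ (x %ℕ n)) (x /ℕ n) (+ n))))
    where lemma : ∀ r q n → r - (r + q * n) ≡ - q * n
          lemma = solve-∀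

  res-≋ : ∀ a b → + res n a b ≋ + a - + b
  res-≋ a b = %ℕ-≋ (+ a - + b)

  ≋⇒≡ : ∀ {x y} → x ≋ y → ∣ x - y ∣ < n → x ≡ y
  ≋⇒≡ {x} {y} x≋y ∣x-y∣<n =
    ℤ.i-j≡0⇒i≡j x y (ℤ.∣i∣≡0⇒i≡0 (small-multiple (ℤ∣.∣⇒∣ᵤ (n∣x-y x≋y)) ∣x-y∣<n))
    where
    small-multiple : ∀ {k} → n ℕ∣.∣ k → k < n → k ≡ 0
    small-multiple {zero}  _   _   = refl
    small-multiple {suc k} n∣k k<n = contradiction (ℕ∣.∣⇒≤ n∣k) (ℕ.<⇒≱ k<n)

  ≋-bounded⇒≡ : ∀ {x y} → ∣ x ∣ ℕ.+ ∣ y ∣ < n → x ≋ y → x ≡ y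
  ≋-bounded⇒≡ {x} {y} bound x≋y = ≋⇒≡ x≋y (ℕ.≤-<-trans (ℤ.∣i-j∣≤∣i∣+∣j∣ x y) bound)

  ≋⇒≡-ℕ : ∀ {a b} → a < n → b < n → + a ≋ + b → a ≡ b
  ≋⇒≡-ℕ {a} {b} a<n b<n a≋b =
    ℤ.+-injective (≋⇒≡ a≋b (subst (_< n) (cong ∣_∣ (sym (ℤ.[+m]-[+n]≡m⊖n a b))) ∣a⊖b∣<n))
    where
    ∣a⊖b∣<n : ∣ a ⊖ b ∣ < n
    ∣a⊖b∣<n with ℕ.≤-total a b
    ... | inj₁ a≤b = subst (_< n) (sym (ℤ.∣⊖∣-≤ a≤b)) (ℕ.≤-<-trans (ℕ.m∸n≤m b a) b<n)
    ... | inj₂ b≤a =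
      subst (_< n) (trans (sym (ℤ.∣⊖∣-≤ b≤a)) (ℤ.∣m⊖n∣≡∣n⊖m∣ b a)) (ℕ.≤-<-trans (ℕ.m∸n≤m a b) a<n)

  ≋⇒≡-InRange : ∀ {a b} → InRange n a → InRange n b → + a ≋ + b → a ≡ b
  ≋⇒≡-InRange {suc a} {suc b} (_ , a<n) (_ , b<n) a+1≋b+1 = cong suc (≋⇒≡-ℕ a<n b<n (≋-resp (lemma a b) a+1≋b+1))
    where lemma : ∀ a b → + suc a - + suc b ≡ + a - + b
          lemma a b = trans (ℤ.[+m]-[+n]≡m⊖n (suc a) (suc b)) (trans (ℤ.[1+m]⊖[1+n]≡m⊖n a b) (sym (ℤ.[+m]-[+n]≡m⊖n a b)))

  res-cong : ∀ {a b a' b'} → + a - + b ≋ + a' - + b' → res n a b ≡ res n a' b'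
  res-cong {a} {b} {a'} {b'} eq = ≋⇒≡-ℕ (n%ℕd<d (+ a - + b) n) (n%ℕd<d (+ a' - + b') n) (begin
    + res n a b     ≈⟨ res-≋ a b ⟩
    + a - + b       ≈⟨ eq ⟩
    + a' - + b'     ≈⟨ ≋-sym (res-≋ a' b') ⟩
    + res n a' b'   ∎)
    where open ≋-Reasoning

  res-complement : ∀ a b → 0 < res n a b → res n b a ≡ n ∸ res n a b
  res-complement a b 0<v = ≋⇒≡-ℕ (n%ℕd<d (+ b - + a) n) (ℕ.∸-monoʳ-< 0<v (ℕ.<⇒≤ v<n)) (begin
    + res n b a          ≈⟨ res-≋ b a ⟩
    + b - + a            ≡⟨ lemma (+ a) (+ b) ⟩
    0ℤ - (+ a - + b)     ≈⟨ -‿cong₂-≋ (≋-sym n≋0) (≋-sym (res-≋ a b)) ⟩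
    + n - + res n a b    ≡⟨ trans (ℤ.[+m]-[+n]≡m⊖n n (res n a b)) (ℤ.⊖-≥ (ℕ.<⇒≤ v<n)) ⟩
    + (n ∸ res n a b)    ∎)
    where open ≋-Reasoning
          v<n : res n a b < n
          v<n = n%ℕd<d (+ a - + b) n
          lemma : ∀ a b → b - a ≡ 0ℤ - (a - b)
          lemma = solve-∀

  *-congˡ-≋ : ∀ k {a b} → a ≋ b → k * a ≋ k * b
  *-congˡ-≋ k {a} {b} (mod a≋b) = mod (subst (+ n ℤ∣.∣_) (lemma k a b) (ℤ∣.∣n⇒∣m*n k a≋b))
    where lemma : ∀ k a b → k * (a - b) ≡ k * a - k * b
          lemma = solve-∀

  ≡-mod⇒≋ : ∀ {x y} → x %ℕ n ≡ y %ℕ n → x ≋ y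
  ≡-mod⇒≋ {x} {y} eq = begin
    x             ≈⟨ ≋-sym (%ℕ-≋ x) ⟩
    + (x %ℕ n)    ≡⟨ cong +_ eq ⟩
    + (y %ℕ n)    ≈⟨ %ℕ-≋ y ⟩
    y             ∎
    where open ≋-Reasoning

  latin-≋-injective : ∀ {A} → LatinRow n A → ∀ {i j} → InRange n i → InRange n j → + A i ≋ + A j → i ≡ j
  latin-≋-injective (in-range , injective) i∈ j∈ Ai≋Aj =
    injective _ _ i∈ j∈ (≋⇒≡-InRange (in-range _ i∈) (in-range _ j∈) Ai≋Aj)

  latin-hits-every-class : ∀ {A} → LatinRow n A → ∀ x → ∃ λ j → InRange n j × + A j ≋ x
  latin-hits-every-class {A} LA x = hit (injective⇒surjective entry-injective (class x))
    where
    column : Fin n → ℕ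
    column i = suc (toℕ i)
    column-in-range : ∀ i → InRange n (column i)
    column-in-range i = s≤s z≤n , Fin.toℕ<n i
    class : ℤ → Fin n
    class y = fromℕ< (n%ℕd<d y n)
    entry : Fin n → Fin n
    entry i = class (+ A (column i))
    toℕ-class : ∀ y → toℕ (class y) ≡ y %ℕ n
    toℕ-class y = Fin.toℕ-fromℕ< (n%ℕd<d y n)
    entry-injective : Injective _≡_ _≡_ entry
    entry-injective {i} {i'} eq = Fin.toℕ-injective (ℕ.suc-injective
      (latin-≋-injective LA (column-in-range i) (column-in-range i')
        (≡-mod⇒≋ (trans (sym (toℕ-class (+ A (column i)))) (trans (cong toℕ eq) (toℕ-class (+ A (column i'))))))))
    hit : (∃ λ i → entry i ≡ class x) → ∃ λ j → InRange n j × + A j ≋ x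
    hit (i , entry-i≡class-x) = column i , column-in-range i ,
      ≡-mod⇒≋ (trans (sym (toℕ-class (+ A (column i)))) (trans (cong toℕ entry-i≡class-x) (toℕ-class x)))

  res-shift-invariant : ∀ {a b a' b'} K → + a' ≋ + a + K → + b' ≋ + b + K → res n b' a' ≡ res n b a
  res-shift-invariant {a} {b} {a'} {b'} K a'≋ b'≋ = res-cong {b'} {a'} {b} {a} (begin
    + b' - + a'               ≈⟨ -‿cong₂-≋ b'≋ a'≋ ⟩
    (+ b + K) - (+ a + K)     ≡⟨ lemma (+ a) (+ b) K ⟩
    + b - + a                 ∎)
    where open ≋-Reasoning
          lemma : ∀ a b K → (b + K) - (a + K) ≡ b - a
          lemma = solve-∀

  1∈range : InRange n 1
  1∈range = ℕ.≤-refl , ℕ.>-nonZero⁻¹ n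

  nxt-< : ∀ {j} → j < n → nxt n j ≡ suc j
  nxt-< {j} j<n with j ℕ.<ᵇ n in eq
  ... | true  = refl
  ... | false = ⊥-elim (subst T eq (ℕ.<⇒<ᵇ j<n))

  nxt-in-range : ∀ {j} → InRange n j → InRange n (nxt n j)
  nxt-in-range {j} _ with j ℕ.<ᵇ n in eq
  ... | true  = s≤s z≤n , ℕ.<ᵇ⇒< j n (subst T (sym eq) tt)
  ... | false = 1∈range

  addConst-≋ : ∀ c X j → 1 ≤ X j → + addConst n c X j ≋ + X j + + c
  addConst-≋ c X j 1≤Xj = begin
    1ℤ + + ((X j ℕ.+ c ∸ 1) ℕ.% n)   ≈⟨ +-cong-≋ (≋-refl {1ℤ}) (%ℕ-≋ (+ (X j ℕ.+ c ∸ 1))) ⟩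
    + suc (X j ℕ.+ c ∸ 1)            ≡⟨ cong +_ (trans (ℕ.+-comm 1 _) (ℕ.m∸n+n≡m (ℕ.≤-trans 1≤Xj (ℕ.m≤m+n (X j) c)))) ⟩
    + (X j ℕ.+ c)                    ≡⟨ ℤ.pos-+ (X j) c ⟩
    + X j + + c                      ∎
    where open ≋-Reasoning

  Shifted : Row → Row → Set
  Shifted X Y = ∃ λ t → ∀ {j} → InRange n j → + Y j ≋ + X j + t

  SameDiffs : Row → Row → Set
  SameDiffs X Y = ∀ j → 1 ≤ j → j < n → res n (X (suc j)) (X j) ≡ res n (Y (suc j)) (Y j)

  shifted-sym : ∀ {X Y} → Shifted X Y → Shifted Y X
  shifted-sym {X} {Y} (t , Y≋X+t) = - t , λ {j} j∈ → begin
    + X j                ≡⟨ lemma (+ X j) t ⟩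
    (+ X j + t) + - t    ≈⟨ +-cong-≋ (≋-sym (Y≋X+t j∈)) ≋-refl ⟩
    + Y j + - t          ∎
    where open ≋-Reasoning
          lemma : ∀ x t → x ≡ (x + t) + - t
          lemma = solve-∀

  shifted⇒same-diffs : ∀ {X Y} → Shifted X Y → SameDiffs X Y
  shifted⇒same-diffs (t , Y≋X+t) j 1≤j j<n =
    sym (res-shift-invariant t (Y≋X+t (1≤j , ℕ.<⇒≤ j<n)) (Y≋X+t (s≤s z≤n , j<n)))

  same-diffs⇒shifted : ∀ {X Y} → SameDiffs X Y → Shifted X Y
  same-diffs⇒shifted {X} {Y} same = gap 1 , λ {j} j∈ → begin
    + Y j                    ≡⟨ lemma (+ X j) (+ Y j) ⟩
    + X j + gap j            ≈⟨ +-cong-≋ (≋-refl {+ X j}) (spread-up (λ k → gap k ≋ gap 1) step ≋-refl (proj₁ j∈) (s≤s (proj₂ j∈))) ⟩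
    + X j + gap 1            ∎
    where
    open ≋-Reasoning
    gap : ℕ → ℤ
    gap j = + Y j - + X j
    lemma : ∀ x y → y ≡ x + (y - x)
    lemma = solve-∀
    step : ∀ k → 1 ≤ k → suc k < suc n → gap k ≋ gap 1 → gap (suc k) ≋ gap 1
    step k 1≤k (s≤s k<n) gapk≋ = begin
      gap (suc k)                                                       ≡⟨ lemma′ (+ X k) (+ X (suc k)) (+ Y k) (+ Y (suc k)) ⟩
      gap k + ((+ Y (suc k) - + Y k) - (+ X (suc k) - + X k))           ≈⟨ +-cong-≋ gapk≋ (-‿cong₂-≋ (≋-sym (res-≋ (Y (suc k)) (Y k))) (≋-sym (res-≋ (X (suc k)) (X k)))) ⟩
      gap 1 + (+ res n (Y (suc k)) (Y k) - + res n (X (suc k)) (X k))   ≡⟨ cong (λ r → gap 1 + (+ r - + res n (X (suc k)) (X k))) (sym (same k 1≤k k<n)) ⟩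
      gap 1 + (+ res n (X (suc k)) (X k) - + res n (X (suc k)) (X k))   ≡⟨ lemma″ (gap 1) (+ res n (X (suc k)) (X k)) ⟩
      gap 1                                                             ∎
      where lemma′ : ∀ x x' y y' → y' - x' ≡ (y - x) + ((y' - y) - (x' - x))
            lemma′ = solve-∀
            lemma″ : ∀ g r → g + (r - r) ≡ g
            lemma″ = solve-∀

  any-in-range? : ∀ {P : ℕ → Set} → (∀ j → Dec (P j)) → Dec (∃ λ j → InRange n j × P j)
  any-in-range? {P} P? = Dec.map′ from to (ℕ.anyUpTo? (λ k → P? (suc k)) n)
    where
    from : (∃ λ k → k < n × P (suc k)) → ∃ λ j → InRange n j × P j
    from (k , k<n , Pk+1) = suc k , (s≤s z≤n , k<n) , Pk+1
    to : (∃ λ j → InRange n j × P j) → ∃ λ k → k < n × P (suc k)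
    to (suc k , (_ , k<n) , Pj) = k , k<n , Pj

  sumFrom-telescopes : ∀ (g δ : ℕ → ℤ) a len → (∀ k → a ≤ k → k < a ℕ.+ len → g k ≡ δ (suc k) - δ k)
                     → sumFrom n g a len ≡ δ (a ℕ.+ len) - δ a
  sumFrom-telescopes g δ a zero _ =
    trans (sym (ℤ.+-inverseʳ (δ a))) (cong (λ k → δ k - δ a) (sym (ℕ.+-identityʳ a)))
  sumFrom-telescopes g δ a (suc len) step = begin
    g a + sumFrom n g (suc a) len                       ≡⟨ cong₂ _+_ (step a ℕ.≤-refl a<a+1+len)
                                                            (sumFrom-telescopes g δ (suc a) len step′) ⟩
    (δ (suc a) - δ a) + (δ (suc a ℕ.+ len) - δ (suc a))  ≡⟨ lemma (δ a) (δ (suc a)) (δ (suc a ℕ.+ len)) ⟩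
    δ (suc a ℕ.+ len) - δ a                             ≡⟨ cong (λ k → δ k - δ a) (sym (ℕ.+-suc a len)) ⟩
    δ (a ℕ.+ suc len) - δ a                             ∎
    where
    open ≡-Reasoning
    a<a+1+len : a < a ℕ.+ suc len
    a<a+1+len = ℕ.m<m+n a (s≤s z≤n)
    step′ : ∀ k → suc a ≤ k → k < suc a ℕ.+ len → g k ≡ δ (suc k) - δ k
    step′ k a<k k<a+1+len = step k (ℕ.<⇒≤ a<k) (subst (k <_) (sym (ℕ.+-suc a len)) k<a+1+len)
    lemma : ∀ x y z → (y - x) + (z - y) ≡ z - x
    lemma = solve-∀

  module Propagation {A B : Row} (LA : LatinRow n A) (LB : LatinRow n B)
    (K lo s : ℤ) (s≉0 : ¬ s ≋ 0ℤ) (δ : ℕ → ℤ)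
    (δ-two-valued : ∀ {j} → InRange n j → δ j ≡ lo ⊎ δ j ≡ lo + s)
    (B≋A+K+δ : ∀ {j} → InRange n j → + B j ≋ + A j + K + δ j) where

    High : ℕ → Set
    High j = δ j ≡ lo + s

    -- Were δ k low, B k ≡ A l + s + K + lo ≡ B l for the column l with A l ≡ A j + s i,
    -- which is high by induction; then k = l and s ≡ 0.
    high-propagatesᴺ : ∀ i {j k} → InRange n j → InRange n k → High j → + A k ≋ + A j + s * + i → High k
    high-propagatesᴺ zero {j} {k} j∈ k∈ high-j Ak≋ =
      subst High (latin-≋-injective LA j∈ k∈ (≋-sym (≋-trans Ak≋ (≋-reflexive (lemma (+ A j) s))))) high-j
      where lemma : ∀ a s → a + s * 0ℤ ≡ a
            lemma = solve-∀
    high-propagatesᴺ (suc i) {j} {k} j∈ k∈ high-j Ak≋ = via (latin-hits-every-class LA (+ A j + s * + i))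
      where
      via : (∃ λ l → InRange n l × + A l ≋ + A j + s * + i) → High k
      via (l , l∈ , Al≋) = high-k (δ-two-valued k∈)
        where
        open ≋-Reasoning
        Ak≋Al+s : + A k ≋ + A l + s
        Ak≋Al+s = begin
          + A k                  ≈⟨ Ak≋ ⟩
          + A j + s * (1ℤ + + i) ≡⟨ lemma (+ A j) s (+ i) ⟩
          (+ A j + s * + i) + s  ≈⟨ +-cong-≋ (≋-sym Al≋) ≋-refl ⟩
          + A l + s              ∎
          where lemma : ∀ a s i → a + s * (1ℤ + i) ≡ (a + s * i) + s
                lemma = solve-∀
        low-k⇒Bk≋Bl : δ k ≡ lo → + B k ≋ + B l
        low-k⇒Bk≋Bl δk≡lo = begin
          + B k                  ≈⟨ B≋A+K+δ k∈ ⟩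
          + A k + K + δ k        ≡⟨ cong (_+_ (+ A k + K)) δk≡lo ⟩
          + A k + K + lo         ≈⟨ +-cong-≋ (+-cong-≋ Ak≋Al+s ≋-refl) ≋-refl ⟩
          + A l + s + K + lo     ≡⟨ lemma (+ A l) s K lo ⟩
          + A l + K + (lo + s)   ≡⟨ cong (_+_ (+ A l + K)) (sym (high-propagatesᴺ i j∈ l∈ high-j Al≋)) ⟩
          + A l + K + δ l        ≈⟨ ≋-sym (B≋A+K+δ l∈) ⟩
          + B l                  ∎
          where lemma : ∀ a s K lo → a + s + K + lo ≡ a + K + (lo + s)
                lemma = solve-∀
        k≡l⇒s≋0 : k ≡ l → s ≋ 0ℤ
        k≡l⇒s≋0 refl = begin
          s                      ≡⟨ lemma (+ A k) s ⟩
          (+ A k + s) - + A k    ≈⟨ -‿cong₂-≋ (≋-sym Ak≋Al+s) ≋-refl ⟩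
          + A k - + A k          ≡⟨ ℤ.+-inverseʳ (+ A k) ⟩
          0ℤ                     ∎
          where lemma : ∀ a s → s ≡ (a + s) - a
                lemma = solve-∀
        high-k : δ k ≡ lo ⊎ High k → High k
        high-k (inj₁ δk≡lo) = contradiction (k≡l⇒s≋0 (latin-≋-injective LB k∈ l∈ (low-k⇒Bk≋Bl δk≡lo))) s≉0
        high-k (inj₂ high-k) = high-k

    high-propagates : ∀ i {j k} → InRange n j → InRange n k → High j → + A k ≋ + A j + s * i → High k
    high-propagates i {j} j∈ k∈ high-j Ak≋ =
      high-propagatesᴺ (i %ℕ n) j∈ k∈ high-j (≋-trans Ak≋ (+-cong-≋ (≋-refl {+ A j}) (*-congˡ-≋ s (≋-sym (%ℕ-≋ i)))))

    constant-along-shifts : ∀ i {j k} → InRange n j → InRange n k → + A k ≋ + A j + s * i → δ k ≡ δ j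
    constant-along-shifts i {j} {k} j∈ k∈ Ak≋ with δ-two-valued j∈ | δ-two-valued k∈
    ... | inj₁ δj≡lo | inj₁ δk≡lo = trans δk≡lo (sym δj≡lo)
    ... | inj₂ high-j | _         = trans (high-propagates i j∈ k∈ high-j Ak≋) (sym high-j)
    ... | inj₁ _     | inj₂ high-k = trans high-k (sym (high-propagates (- i) k∈ j∈ high-k Aj≋))
      where
      Aj≋ : + A j ≋ + A k + s * - i
      Aj≋ = begin
        + A j                         ≡⟨ lemma (+ A j) s i ⟩
        (+ A j + s * i) + s * - i     ≈⟨ +-cong-≋ (≋-sym Ak≋) ≋-refl ⟩
        + A k + s * - i               ∎
        where open ≋-Reasoning
              lemma : ∀ a s i → a ≡ (a + s * i) + s * - i
              lemma = solve-∀

    constant-if-unit : s ≡ 1ℤ → ∀ {j k} → InRange n j → InRange n k → δ k ≡ δ j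
    constant-if-unit refl {j} {k} j∈ k∈ = constant-along-shifts (+ A k - + A j) j∈ k∈ (≋-reflexive (lemma (+ A k) (+ A j)))
      where lemma : ∀ a b → a ≡ b + 1ℤ * (a - b)
            lemma = solve-∀

-- Offsets between symbols at distance at least n / 2 - 1

module EvenOrder (n : ℕ) .{{_ : NonZero n}} (m : ℕ) (n≡m+m : n ≡ m ℕ.+ m) (3≤m : 3 ≤ m) where

  open Modular n

  half≡m : n / 2 ≡ m
  half≡m = begin
    n / 2        ≡⟨ cong (_/ 2) (trans n≡m+m (sym (m*2≡m+m m))) ⟩
    m ℕ.* 2 / 2  ≡⟨ m*n/n≡m m 2 ⟩
    m            ∎
    where open ≡-Reasoning

  half : ℤ
  half = + (n / 2)

  half+half≡n : half + half ≡ + n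
  half+half≡n = trans (cong (λ h → + h + + h) half≡m) (trans (sym (ℤ.pos-+ m m)) (cong +_ (sym n≡m+m)))

  6≤n : 6 ≤ n
  6≤n = ℕ.≤-trans (ℕ.+-mono-≤ 3≤m 3≤m) (ℕ.≤-reflexive (sym n≡m+m))

  2<n : 2 < n
  2<n = ℕ.≤-trans (s≤s (s≤s (s≤s z≤n))) 6≤n

  4<n : 4 < n
  4<n = ℕ.≤-trans (ℕ.n≤1+n 5) 6≤n

  ≉0 : ∀ {k} → 0 < k → k < n → ¬ + k ≋ 0ℤ
  ≉0 {suc k} _ k<n k≋0 with ≋⇒≡ k≋0 (subst (λ x → suc x < n) (sym (ℕ.+-identityʳ k)) k<n)
  ... | ()

  1≉0 : ¬ 1ℤ ≋ 0ℤ
  1≉0 = ≉0 (s≤s z≤n) (ℕ.<-trans (s≤s (s≤s z≤n)) 2<n)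

  trit-≋⇒≡ : ∀ {e f} → Trit e → Trit f → e ≋ f → e ≡ f
  trit-≋⇒≡ te tf = ≋-bounded⇒≡ (ℕ.≤-<-trans (ℕ.+-mono-≤ (∣trit∣≤1 te) (∣trit∣≤1 tf)) 2<n)

  -- extDiff n r j unfolds to offset (r (nxt n j)) (r j).
  offset : ℕ → ℕ → ℤ
  offset b a = + res n b a - half

  offset-≋ : ∀ a b → offset b a ≋ + b - + a - half
  offset-≋ a b = -‿cong₂-≋ (res-≋ b a) ≋-refl

  offset-step : ∀ a b → + b ≋ + a + half + offset b a
  offset-step a b = begin
    + b                                 ≡⟨ lemma (+ a) (+ b) half ⟩
    + a + half + (+ b - + a - half)     ≈⟨ +-cong-≋ (≋-refl {+ a + half}) (≋-sym (offset-≋ a b)) ⟩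
    + a + half + offset b a             ∎
    where open ≋-Reasoning
          lemma : ∀ a b h → b ≡ a + h + (b - a - h)
          lemma = solve-∀

  half-twice : ∀ x a b → x + half + a + half + b ≋ x + (a + b)
  half-twice x a b = begin
    x + half + a + half + b        ≡⟨ lemma x a b half ⟩
    x + (a + b) + (half + half)    ≡⟨ cong (_+_ (x + (a + b))) half+half≡n ⟩
    x + (a + b) + + n              ≈⟨ +-cong-≋ (≋-refl {x + (a + b)}) n≋0 ⟩
    x + (a + b) + 0ℤ               ≡⟨ ℤ.+-identityʳ (x + (a + b)) ⟩
    x + (a + b)                    ∎
    where open ≋-Reasoning
          lemma : ∀ x a b h → x + h + a + h + b ≡ x + (a + b) + (h + h)
          lemma = solve-∀

  offset-step₂ : ∀ a b c → + c ≋ + a + (offset b a + offset c b)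
  offset-step₂ a b c = begin
    + c                                     ≈⟨ offset-step b c ⟩
    + b + half + offset c b                 ≈⟨ +-cong-≋ (+-cong-≋ (offset-step a b) (≋-refl {half})) (≋-refl {offset c b}) ⟩
    + a + half + offset b a + half + offset c b   ≈⟨ half-twice (+ a) (offset b a) (offset c b) ⟩
    + a + (offset b a + offset c b)         ∎
    where open ≋-Reasoning

  offset-shift-invariant : ∀ {a b a' b'} K → + a' ≋ + a + K → + b' ≋ + b + K → offset b' a' ≡ offset b a
  offset-shift-invariant K a'≋ b'≋ = cong (λ r → + r - half) (res-shift-invariant K a'≋ b'≋)

  trit-offset : ∀ a b → bound n ≤ dist n a b → Trit (offset b a)
  trit-offset a b bound≤dist = subst Trit (sym offset≡u⊖m) (trit-⊖ u m m≤u+1 u≤m+1)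
    where
    u v : ℕ
    u = res n b a
    v = res n a b
    m-1≤v⊓u : m ∸ 1 ≤ v ℕ.⊓ u
    m-1≤v⊓u = subst (λ h → h ∸ 1 ≤ v ℕ.⊓ u) half≡m bound≤dist
    m-1≤u : m ∸ 1 ≤ u
    m-1≤u = ℕ.≤-trans m-1≤v⊓u (ℕ.m⊓n≤n v u)
    m-1≤v : m ∸ 1 ≤ v
    m-1≤v = ℕ.≤-trans m-1≤v⊓u (ℕ.m⊓n≤m v u)
    m≤u+1 : m ≤ suc u
    m≤u+1 = ℕ.≤-trans (ℕ.m≤n+m∸n m 1) (s≤s m-1≤u)
    0<v : 0 < v
    0<v = ℕ.<-≤-trans (ℕ.∸-monoˡ-< {n = 1} (ℕ.≤-trans (s≤s (s≤s z≤n)) 3≤m) (s≤s z≤n)) m-1≤v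
    u≤m+1 : u ≤ suc m
    u≤m+1 = begin
      u                      ≡⟨ res-complement a b 0<v ⟩
      n ∸ v                  ≤⟨ ℕ.∸-monoʳ-≤ n m-1≤v ⟩
      n ∸ (m ∸ 1)            ≡⟨ cong (_∸ (m ∸ 1)) n≡m+m ⟩
      m ℕ.+ m ∸ (m ∸ 1)      ≡⟨ ℕ.+-∸-assoc m (ℕ.m∸n≤m m 1) ⟩
      m ℕ.+ (m ∸ (m ∸ 1))    ≡⟨ cong (m ℕ.+_) (ℕ.m∸[m∸n]≡n (ℕ.≤-trans (s≤s z≤n) 3≤m)) ⟩
      m ℕ.+ 1                ≡⟨ ℕ.+-comm m 1 ⟩
      suc m                  ∎
      where open ℕ.≤-Reasoning
    offset≡u⊖m : offset b a ≡ u ⊖ m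
    offset≡u⊖m = trans (cong (λ h → + u - + h) half≡m) (ℤ.[+m]-[+n]≡m⊖n u m)

  offset-square : ∀ a a' b b' K {d d'} → Trit (offset a' a) → Trit (offset b' b) → Trit d → Trit d'
                → + b ≋ + a + K + d → + b' ≋ + a' + K + d'
                → offset b' b - offset a' a ≡ d' - d
  offset-square a a' b b' K {d} {d'} te tf td td' b≋ b'≋ =
    ≋-bounded⇒≡ (ℕ.≤-<-trans (ℕ.+-mono-≤ (∣trit-trit∣≤2 tf te) (∣trit-trit∣≤2 td' td)) 4<n) (begin
      f - e                                                  ≡⟨ lemma₁ (+ a) (+ b) e f half ⟩
      (+ b + half + f) - (+ a + half + e) - (+ b - + a)      ≈⟨ -‿cong₂-≋ (-‿cong₂-≋ (≋-sym (offset-step b b')) (≋-sym (offset-step a a'))) ≋-refl ⟩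
      + b' - + a' - (+ b - + a)                              ≈⟨ -‿cong₂-≋ (-‿cong₂-≋ b'≋ ≋-refl) (-‿cong₂-≋ b≋ ≋-refl) ⟩
      (+ a' + K + d') - + a' - ((+ a + K + d) - + a)         ≡⟨ lemma₂ (+ a) (+ a') K d d' ⟩
      d' - d                                                 ∎)
    where
    open ≋-Reasoning
    e f : ℤ
    e = offset a' a
    f = offset b' b
    ∣trit-trit∣≤2 : ∀ {x y} → Trit x → Trit y → ∣ x - y ∣ ≤ 2
    ∣trit-trit∣≤2 {x} {y} tx ty = ℕ.≤-trans (ℤ.∣i-j∣≤∣i∣+∣j∣ x y) (ℕ.+-mono-≤ (∣trit∣≤1 tx) (∣trit∣≤1 ty))
    lemma₁ : ∀ a b e f h → f - e ≡ (b + h + f) - (a + h + e) - (b - a)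
    lemma₁ = solve-∀
    lemma₂ : ∀ a a' K d d' → (a' + K + d') - a' - ((a + K + d) - a) ≡ d' - d
    lemma₂ = solve-∀

  -- Neighbouring rows

  extDiff-addConst : ∀ {X} c → LatinRow n X → ∀ {j} → InRange n j
                   → extDiff n X j ≡ offset (addConst n c X (nxt n j)) (addConst n c X j)
  extDiff-addConst {X} c (in-range , _) {j} j∈ = sym (offset-shift-invariant (+ c)
    (addConst-≋ c X j (proj₁ (in-range j j∈)))
    (addConst-≋ c X (nxt n j) (proj₁ (in-range (nxt n j) (nxt-in-range j∈)))))

  module NeighborPair {r r' : Row} (c c' : ℕ) (Lr : LatinRow n r) (Lr' : LatinRow n r')
    (LA : LatinRow n (addConst n c r)) (LB : LatinRow n (addConst n c' r'))
    (MA : MaxInnerDist n (addConst n c r)) (MB : MaxInnerDist n (addConst n c' r'))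
    (vertical : ∀ j → InRange n j → bound n ≤ dist n (addConst n c r j) (addConst n c' r' j)) where

    A B : Row
    A = addConst n c r
    B = addConst n c' r'

    δ : ℕ → ℤ
    δ j = offset (B j) (A j)

    trit-δ : ∀ {j} → InRange n j → Trit (δ j)
    trit-δ {j} j∈ = trit-offset (A j) (B j) (vertical j j∈)

    extDiff-difference : ∀ {k} → 1 ≤ k → k < n → extDiff n r' k - extDiff n r k ≡ δ (suc k) - δ k
    extDiff-difference {k} 1≤k k<n = begin
      extDiff n r' k - extDiff n r k                               ≡⟨ cong₂ _-_ (extDiff-addConst c' Lr' k∈) (extDiff-addConst c Lr k∈) ⟩
      offset (B (nxt n k)) (B k) - offset (A (nxt n k)) (A k)      ≡⟨ cong (λ k′ → offset (B k′) (B k) - offset (A k′) (A k)) (nxt-< k<n) ⟩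
      offset (B (suc k)) (B k) - offset (A (suc k)) (A k)          ≡⟨ offset-square (A k) (A (suc k)) (B k) (B (suc k)) half
                                                                        (trit-offset (A k) (A (suc k)) (MA k 1≤k k<n))
                                                                        (trit-offset (B k) (B (suc k)) (MB k 1≤k k<n))
                                                                        (trit-δ k∈) (trit-δ (s≤s z≤n , k<n))
                                                                        (offset-step (A k) (B k)) (offset-step (A (suc k)) (B (suc k))) ⟩
      δ (suc k) - δ k                                              ∎
      where open ≡-Reasoning
            k∈ : InRange n k
            k∈ = 1≤k , ℕ.<⇒≤ k<n

    telescope : ∀ {p q} → 1 ≤ p → p < q → q ≤ n
              → sumFrom n (λ j → extDiff n r' j - extDiff n r j) p (q ∸ p) ≡ δ q - δ p
    telescope {p} {q} 1≤p p<q q≤n =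
      trans (sumFrom-telescopes _ δ p (q ∸ p) step) (cong (λ k → δ k - δ p) p+[q-p]≡q)
      where
      p+[q-p]≡q : p ℕ.+ (q ∸ p) ≡ q
      p+[q-p]≡q = ℕ.m+[n∸m]≡n (ℕ.<⇒≤ p<q)
      step : ∀ k → p ≤ k → k < p ℕ.+ (q ∸ p) → extDiff n r' k - extDiff n r k ≡ δ (suc k) - δ k
      step k p≤k k<q = extDiff-difference (ℕ.≤-trans 1≤p p≤k) (ℕ.<-≤-trans (subst (k <_) p+[q-p]≡q k<q) q≤n)

    jump⇒determined : ∀ {p q} → InRange n p → InRange n q → δ p ≡ -1ℤ → δ q ≡ 1ℤ
                    → Determined n (extDiff n r) (extDiff n r')
    jump⇒determined {p} {q} (1≤p , p≤n) (1≤q , q≤n) δp≡-1 δq≡1 with ℕ.<-cmp p q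
    ... | tri< p<q _ _ = p , q , 1≤p , p<q , q≤n , cong ∣_∣ (trans (telescope 1≤p p<q q≤n) (cong₂ _-_ δq≡1 δp≡-1))
    ... | tri> _ _ q<p = q , p , 1≤q , q<p , p≤n , cong ∣_∣ (trans (telescope 1≤q q<p p≤n) (cong₂ _-_ δp≡-1 δq≡1))
    ... | tri≈ _ refl _ with () ← trans (sym δp≡-1) δq≡1

    two-valued⇒constant : ∀ lo → (∀ {j} → InRange n j → δ j ≡ lo ⊎ δ j ≡ lo + 1ℤ)
                        → ∀ {j} → InRange n j → δ j ≡ δ 1
    two-valued⇒constant lo two-valued j∈ =
      Propagation.constant-if-unit LA LB half lo 1ℤ 1≉0 δ two-valued
        (λ {j} _ → offset-step (A j) (B j)) refl 1∈range j∈

    constant⇒same : (∀ {j} → InRange n j → δ j ≡ δ 1) → SameRow n (extDiff n r) (extDiff n r')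
    constant⇒same δ-constant j j∈ = begin
      extDiff n r j                            ≡⟨ extDiff-addConst c Lr j∈ ⟩
      offset (A (nxt n j)) (A j)               ≡⟨ offset-shift-invariant (half + δ 1) (B≋ j∈) (B≋ (nxt-in-range j∈)) ⟨
      offset (B (nxt n j)) (B j)               ≡⟨ extDiff-addConst c' Lr' j∈ ⟨
      extDiff n r' j                           ∎
      where
      open ≡-Reasoning
      B≋ : ∀ {k} → InRange n k → + B k ≋ + A k + (half + δ 1)
      B≋ {k} k∈ = ≋-trans (offset-step (A k) (B k))
        (≋-reflexive (trans (ℤ.+-assoc (+ A k) half (δ k)) (cong (λ d → + A k + (half + d)) (δ-constant k∈))))

    determined : ¬ SameRow n (extDiff n r) (extDiff n r') → Determined n (extDiff n r) (extDiff n r')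
    determined not-same = by-cases (any-in-range? (λ j → δ j ℤ.≟ -1ℤ)) (any-in-range? (λ j → δ j ℤ.≟ 1ℤ))
      where
      by-cases : Dec (∃ λ j → InRange n j × δ j ≡ -1ℤ) → Dec (∃ λ j → InRange n j × δ j ≡ 1ℤ)
               → Determined n (extDiff n r) (extDiff n r')
      by-cases (yes (p , p∈ , δp≡-1)) (yes (q , q∈ , δq≡1)) = jump⇒determined p∈ q∈ δp≡-1 δq≡1
      by-cases (no ∄-1) _ = contradiction (constant⇒same (two-valued⇒constant 0ℤ
        (λ j∈ → trit≢-1 (trit-δ j∈) (λ δj≡-1 → ∄-1 (_ , j∈ , δj≡-1))))) not-same
      by-cases _ (no ∄1) = contradiction (constant⇒same (two-valued⇒constant -1ℤ
        (λ j∈ → trit≢1 (trit-δ j∈) (λ δj≡1 → ∄1 (_ , j∈ , δj≡1))))) not-same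

  neighbors-determined : ∀ {r r'} → Admissible n r → Admissible n r' → Neighbors n r r'
                       → ¬ SameRow n (extDiff n r) (extDiff n r') → Determined n (extDiff n r) (extDiff n r')
  neighbors-determined (Lr , _) (Lr' , _) (c , c' , LA , LB , _ , MA , MB , vertical) =
    NeighborPair.determined c c' Lr Lr' LA LB MA MB vertical

  -- Consecutive rows of a Latin square

  module SignShift {X Z : Row} (LX : LatinRow n X) (LZ : LatinRow n Z) (MX : MaxInnerDist n X) (MZ : MaxInnerDist n Z)
    (d : ℕ → ℤ) (sign-d : ∀ {j} → InRange n j → Sign (d j))
    (Z≋X+d : ∀ {j} → InRange n j → + Z j ≋ + X j + d j) where

    Z≋X+0+d : ∀ {j} → InRange n j → + Z j ≋ + X j + 0ℤ + d j
    Z≋X+0+d {j} j∈ = ≋-trans (Z≋X+d j∈) (≋-reflexive (cong (_+ d j) (sym (ℤ.+-identityʳ (+ X j)))))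

    even-shift-invariant : ∀ i {j k} → InRange n j → InRange n k → + X k ≋ + X j + + 2 * i → d k ≡ d j
    even-shift-invariant = Propagation.constant-along-shifts LX LZ 0ℤ -1ℤ (+ 2) (≉0 (s≤s z≤n) 2<n) d
      (λ j∈ → sign-cases (sign-d j∈)) Z≋X+0+d

    e : ℕ → ℤ
    e j = offset (X (suc j)) (X j)

    trit-e : ∀ {j} → 1 ≤ j → j < n → Trit (e j)
    trit-e {j} 1≤j j<n = trit-offset (X j) (X (suc j)) (MX j 1≤j j<n)

    jump : ∀ {j} → 1 ≤ j → j < n → d (suc j) ≢ d j → e j + e j ≡ d j - d (suc j)
    jump {j} 1≤j j<n = sign-jump (trit-e 1≤j j<n) trit-f (sign-d j∈) (sign-d j+1∈)
      (offset-square (X j) (X (suc j)) (Z j) (Z (suc j)) 0ℤ (trit-e 1≤j j<n) trit-f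
        (sign⇒trit (sign-d j∈)) (sign⇒trit (sign-d j+1∈)) (Z≋X+0+d j∈) (Z≋X+0+d j+1∈))
      where
      j∈ : InRange n j
      j∈ = 1≤j , ℕ.<⇒≤ j<n
      j+1∈ : InRange n (suc j)
      j+1∈ = s≤s z≤n , j<n
      trit-f : Trit (offset (Z (suc j)) (Z j))
      trit-f = trit-offset (Z j) (Z (suc j)) (MZ j 1≤j j<n)

    jump⇒odd : ∀ {j} → 1 ≤ j → j < n → d (suc j) ≢ d j → ∃ λ k → e j ≡ 1ℤ + + 2 * k
    jump⇒odd {j} 1≤j j<n d≢ = [ zero-case , sign-odd ]′ (trit⇒zero⊎sign (trit-e 1≤j j<n))
      where
      zero-case : e j ≡ 0ℤ → ∃ λ k → e j ≡ 1ℤ + + 2 * k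
      zero-case e≡0 = contradiction
        (sym (ℤ.i-j≡0⇒i≡j (d j) (d (suc j)) (trans (sym (jump 1≤j j<n d≢)) (cong (λ x → x + x) e≡0)))) d≢

    -- With m odd, a step m ± 1 between neighbouring symbols of X is even, so d cannot change.
    odd-constant : ∀ h → m ≡ 1 ℕ.+ 2 ℕ.* h → ∀ {j} → InRange n j → d j ≡ d 1
    odd-constant h m≡2h+1 (1≤j , j≤n) = spread-up (λ k → d k ≡ d 1) step refl 1≤j (s≤s j≤n)
      where
      half≡ : half ≡ 1ℤ + + 2 * + h
      half≡ = trans (cong +_ (trans half≡m m≡2h+1)) (trans (ℤ.pos-+ 1 (2 ℕ.* h)) (cong (_+_ 1ℤ) (ℤ.pos-* 2 h)))
      no-jump : ∀ {k} → 1 ≤ k → k < n → Dec (d (suc k) ≡ d k) → d (suc k) ≡ d k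
      no-jump _   _   (yes d≡) = d≡
      no-jump {k} 1≤k k<n (no d≢) = even-step (jump⇒odd 1≤k k<n d≢)
        where
        even-step : (∃ λ i → e k ≡ 1ℤ + + 2 * i) → d (suc k) ≡ d k
        even-step (i , e≡) = even-shift-invariant (1ℤ + + h + i) (1≤k , ℕ.<⇒≤ k<n) (s≤s z≤n , k<n) (begin
          + X (suc k)                                 ≈⟨ offset-step (X k) (X (suc k)) ⟩
          + X k + half + e k                          ≡⟨ cong₂ (λ a b → + X k + a + b) half≡ e≡ ⟩
          + X k + (1ℤ + + 2 * + h) + (1ℤ + + 2 * i)   ≡⟨ lemma (+ X k) (+ h) i ⟩
          + X k + + 2 * (1ℤ + + h + i)                ∎)
          where open ≋-Reasoning
                lemma : ∀ x h i → x + (1ℤ + + 2 * h) + (1ℤ + + 2 * i) ≡ x + + 2 * (1ℤ + h + i)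
                lemma = solve-∀
      step : ∀ k → 1 ≤ k → suc k < suc n → d k ≡ d 1 → d (suc k) ≡ d 1
      step k 1≤k (s≤s k<n) dk≡d1 = trans (no-jump 1≤k k<n (d (suc k) ℤ.≟ d k)) dk≡d1

    module Even (h : ℕ) (m≡2h : m ≡ 2 ℕ.* h) {p q} (p∈ : InRange n p) (q∈ : InRange n q) (dq≢dp : d q ≢ d p) where

      half≡ : half ≡ + 2 * + h
      half≡ = trans (cong +_ (trans half≡m m≡2h)) (ℤ.pos-* 2 h)

      other : ∀ {j} → Dec (d j ≡ d p) → ∃ λ w → InRange n w × d w ≢ d j
      other (yes dj≡dp) = q , q∈ , λ dq≡dj → dq≢dp (trans dq≡dj dj≡dp)
      other (no dj≢dp)  = p , p∈ , λ dp≡dj → dj≢dp (sym dp≡dj)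

      -- With m even, a nonzero step e j flips the parity of the symbol, on which alone d depends.
      flip : ∀ {j} → 1 ≤ j → j < n → e j ≢ 0ℤ → d (suc j) ≢ d j
      flip {j} 1≤j j<n e≢0 = via-witness (other (d j ℤ.≟ d p))
        where
        j∈ : InRange n j
        j∈ = 1≤j , ℕ.<⇒≤ j<n
        e-odd : ∃ λ k → e j ≡ 1ℤ + + 2 * k
        e-odd = [ (λ e≡0 → contradiction e≡0 e≢0) , sign-odd ]′ (trit⇒zero⊎sign (trit-e 1≤j j<n))
        via-witness : (∃ λ w → InRange n w × d w ≢ d j) → d (suc j) ≢ d j
        via-witness (w , w∈ , dw≢dj) = by-parity e-odd (even⊎odd (res n (X w) (X j)))
          where
          open ≋-Reasoning
          r : ℕ
          r = res n (X w) (X j)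
          Xw≋ : + X w ≋ + X j + + r
          Xw≋ = ≋-trans (≋-reflexive (lemma (+ X j) (+ X w))) (+-cong-≋ (≋-refl {+ X j}) (≋-sym (res-≋ (X w) (X j))))
            where lemma : ∀ x y → y ≡ x + (y - x)
                  lemma = solve-∀
          by-parity : (∃ λ k → e j ≡ 1ℤ + + 2 * k) → (∃ λ i → r ≡ 2 ℕ.* i ⊎ r ≡ 1 ℕ.+ 2 ℕ.* i) → d (suc j) ≢ d j
          by-parity _ (i , inj₁ r≡2i) _ = dw≢dj (even-shift-invariant (+ i) j∈ w∈ (begin
            + X w                 ≈⟨ Xw≋ ⟩
            + X j + + r           ≡⟨ cong (λ x → + X j + + x) r≡2i ⟩
            + X j + + (2 ℕ.* i)   ≡⟨ cong (_+_ (+ X j)) (ℤ.pos-* 2 i) ⟩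
            + X j + + 2 * + i     ∎))
          by-parity (k , e≡) (i , inj₂ r≡2i+1) dj+1≡dj = dw≢dj (trans (even-shift-invariant (+ i - + h - k) (s≤s z≤n , j<n) w∈ (begin
            + X w                                                    ≈⟨ Xw≋ ⟩
            + X j + + r                                              ≡⟨ cong (λ x → + X j + + x) r≡2i+1 ⟩
            + X j + + (1 ℕ.+ 2 ℕ.* i)                                ≡⟨ cong (_+_ (+ X j)) (trans (ℤ.pos-+ 1 (2 ℕ.* i)) (cong (_+_ 1ℤ) (ℤ.pos-* 2 i))) ⟩
            + X j + (1ℤ + + 2 * + i)                                 ≡⟨ lemma (+ X j) (+ h) k (+ i) ⟩
            (+ X j + + 2 * + h + (1ℤ + + 2 * k)) + + 2 * (+ i - + h - k)  ≡⟨ cong₂ (λ a b → (+ X j + a + b) + + 2 * (+ i - + h - k)) (sym half≡) (sym e≡) ⟩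
            (+ X j + half + e j) + + 2 * (+ i - + h - k)             ≈⟨ +-cong-≋ (≋-sym (offset-step (X j) (X (suc j)))) ≋-refl ⟩
            + X (suc j) + + 2 * (+ i - + h - k)                      ∎)) dj+1≡dj)
            where lemma : ∀ x h k i → x + (1ℤ + + 2 * i) ≡ (x + + 2 * h + (1ℤ + + 2 * k)) + + 2 * (i - h - k)
                  lemma = solve-∀

      doubled : ∀ {j} → 1 ≤ j → j < n → e j + e j ≡ d j - d (suc j)
      doubled {j} 1≤j j<n = by-jump (d (suc j) ℤ.≟ d j)
        where
        by-jump : Dec (d (suc j) ≡ d j) → e j + e j ≡ d j - d (suc j)
        by-jump (no d≢) = jump 1≤j j<n d≢
        by-jump (yes d≡) =
          [ e≡0⇒ , (λ sign-e → contradiction d≡ (flip 1≤j j<n (sign≢0 sign-e))) ]′ (trit⇒zero⊎sign (trit-e 1≤j j<n))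
          where e≡0⇒ : e j ≡ 0ℤ → e j + e j ≡ d j - d (suc j)
                e≡0⇒ e≡0 = trans (cong (λ x → x + x) e≡0) (sym (ℤ.i≡j⇒i-j≡0 (sym d≡)))

      E : ℕ → ℤ
      E j = e j + e (suc j)

      E-doubled : ∀ {j} → 1 ≤ j → suc j < n → E j + E j ≡ d j - d (suc (suc j))
      E-doubled {j} 1≤j j+1<n = begin
        E j + E j                                      ≡⟨ lemma (e j) (e (suc j)) ⟩
        (e j + e j) + (e (suc j) + e (suc j))          ≡⟨ cong₂ _+_ (doubled 1≤j (ℕ.<-trans (ℕ.n<1+n j) j+1<n)) (doubled (s≤s z≤n) j+1<n) ⟩
        (d j - d (suc j)) + (d (suc j) - d (suc (suc j)))  ≡⟨ lemma′ (d j) (d (suc j)) (d (suc (suc j))) ⟩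
        d j - d (suc (suc j))                          ∎
        where open ≡-Reasoning
              lemma : ∀ a b → (a + b) + (a + b) ≡ (a + a) + (b + b)
              lemma = solve-∀
              lemma′ : ∀ x y z → (x - y) + (y - z) ≡ x - z
              lemma′ = solve-∀

      skip-differs : ∀ {j} → 1 ≤ j → suc j < n → d (suc (suc j)) ≢ d j
      skip-differs {j} 1≤j j+1<n d≡ =
        j+2≢j (latin-≋-injective LX (s≤s z≤n , j+1<n) (1≤j , ℕ.≤-trans (ℕ.n≤1+n j) (ℕ.<⇒≤ j+1<n)) Xj+2≋Xj)
        where
        j+2≢j : suc (suc j) ≢ j
        j+2≢j ()
        E≡0 : E j ≡ 0ℤ
        E≡0 = x+x≡0⇒x≡0 (trans (E-doubled 1≤j j+1<n) (ℤ.i≡j⇒i-j≡0 (sym d≡)))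
        Xj+2≋Xj : + X (suc (suc j)) ≋ + X j
        Xj+2≋Xj = ≋-trans (offset-step₂ (X j) (X (suc j)) (X (suc (suc j))))
          (≋-reflexive (trans (cong (_+_ (+ X j)) E≡0) (ℤ.+-identityʳ (+ X j))))

      absurd : ⊥
      absurd = contradiction (latin-≋-injective LX 5∈ 1∈range X5≋X1) λ ()
        where
        3<n : 3 < n
        3<n = ℕ.<-trans (s≤s (s≤s (s≤s (s≤s z≤n)))) 4<n
        5∈ : InRange n 5
        5∈ = s≤s z≤n , 4<n
        d5≡d1 : d 5 ≡ d 1
        d5≡d1 = sign-≢-≢⇒≡ (sign-d 5∈) (sign-d (s≤s z≤n , ℕ.<⇒≤ 3<n)) (sign-d 1∈range)
          (skip-differs (s≤s z≤n) 4<n) (skip-differs ℕ.≤-refl 2<n)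
        E₁+E₃≡0 : E 1 + E 3 ≡ 0ℤ
        E₁+E₃≡0 = x+x≡0⇒x≡0 (begin
          (E 1 + E 3) + (E 1 + E 3)        ≡⟨ lemma (E 1) (E 3) ⟩
          (E 1 + E 1) + (E 3 + E 3)        ≡⟨ cong₂ _+_ (E-doubled ℕ.≤-refl 2<n) (E-doubled (s≤s z≤n) 4<n) ⟩
          (d 1 - d 3) + (d 3 - d 5)        ≡⟨ lemma′ (d 1) (d 3) (d 5) ⟩
          d 1 - d 5                        ≡⟨ ℤ.i≡j⇒i-j≡0 (sym d5≡d1) ⟩
          0ℤ                               ∎)
          where open ≡-Reasoning
                lemma : ∀ a b → (a + b) + (a + b) ≡ (a + a) + (b + b)
                lemma = solve-∀
                lemma′ : ∀ x y z → (x - y) + (y - z) ≡ x - z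
                lemma′ = solve-∀
        X5≋X1 : + X 5 ≋ + X 1
        X5≋X1 = begin
          + X 5                  ≈⟨ offset-step₂ (X 3) (X 4) (X 5) ⟩
          + X 3 + E 3            ≈⟨ +-cong-≋ (offset-step₂ (X 1) (X 2) (X 3)) ≋-refl ⟩
          + X 1 + E 1 + E 3      ≡⟨ ℤ.+-assoc (+ X 1) (E 1) (E 3) ⟩
          + X 1 + (E 1 + E 3)    ≡⟨ cong (_+_ (+ X 1)) E₁+E₃≡0 ⟩
          + X 1 + 0ℤ             ≡⟨ ℤ.+-identityʳ (+ X 1) ⟩
          + X 1                  ∎
          where open ≋-Reasoning

    constant : ∀ {j} → InRange n j → d j ≡ d 1
    constant = by-parity (even⊎odd m)
      where
      by-parity : (∃ λ h → m ≡ 2 ℕ.* h ⊎ m ≡ 1 ℕ.+ 2 ℕ.* h) → ∀ {j} → InRange n j → d j ≡ d 1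
      by-parity (h , inj₂ m≡2h+1) = odd-constant h m≡2h+1
      by-parity (h , inj₁ m≡2h) {j} j∈ = decide (d j ℤ.≟ d 1)
        where decide : Dec (d j ≡ d 1) → d j ≡ d 1
              decide (yes dj≡d1) = dj≡d1
              decide (no dj≢d1)  = ⊥-elim (Even.absurd h m≡2h 1∈range j∈ dj≢d1)

  shift-propagates : ∀ {X Y Z} → LatinRow n X → LatinRow n Y → LatinRow n Z → MaxInnerDist n X → MaxInnerDist n Z
                   → (∀ j → InRange n j → bound n ≤ dist n (X j) (Y j)) → (∀ j → InRange n j → bound n ≤ dist n (Y j) (Z j))
                   → (∀ {j} → InRange n j → X j ≢ Z j) → Shifted X Y → Shifted Y Z
  shift-propagates {X} {Y} {Z} LX LY LZ MX MZ XY YZ X≢Z (t , Y≋X+t) = half + d 1 , λ {j} j∈ → begin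
    + Z j                  ≈⟨ offset-step (Y j) (Z j) ⟩
    + Y j + half + d j     ≡⟨ trans (ℤ.+-assoc (+ Y j) half (d j)) (cong (λ x → + Y j + (half + x)) (d-constant j∈)) ⟩
    + Y j + (half + d 1)   ∎
    where
    open ≋-Reasoning
    c : ℕ → ℤ
    c j = offset (Y j) (X j)
    d : ℕ → ℤ
    d j = offset (Z j) (Y j)
    trit-c : ∀ {j} → InRange n j → Trit (c j)
    trit-c {j} j∈ = trit-offset (X j) (Y j) (XY j j∈)
    trit-d : ∀ {j} → InRange n j → Trit (d j)
    trit-d {j} j∈ = trit-offset (Y j) (Z j) (YZ j j∈)
    c≋ : ∀ {j} → InRange n j → c j ≋ t - half
    c≋ {j} j∈ = begin
      c j                          ≈⟨ offset-≋ (X j) (Y j) ⟩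
      + Y j - + X j - half         ≈⟨ -‿cong₂-≋ (-‿cong₂-≋ (Y≋X+t j∈) ≋-refl) (≋-refl {half}) ⟩
      (+ X j + t) - + X j - half   ≡⟨ lemma (+ X j) t half ⟩
      t - half                     ∎
      where lemma : ∀ x t h → (x + t) - x - h ≡ t - h
            lemma = solve-∀
    c-constant : ∀ {j} → InRange n j → c j ≡ c 1
    c-constant j∈ = trit-≋⇒≡ (trit-c j∈) (trit-c 1∈range) (≋-trans (c≋ j∈) (≋-sym (c≋ 1∈range)))
    Z≋X+c+d : ∀ {j} → InRange n j → + Z j ≋ + X j + (c 1 + d j)
    Z≋X+c+d {j} j∈ = begin
      + Z j                             ≈⟨ offset-step (Y j) (Z j) ⟩
      + Y j + half + d j                ≈⟨ +-cong-≋ (+-cong-≋ (offset-step (X j) (Y j)) (≋-refl {half})) (≋-refl {d j}) ⟩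
      + X j + half + c j + half + d j   ≈⟨ half-twice (+ X j) (c j) (d j) ⟩
      + X j + (c j + d j)               ≡⟨ cong (λ x → + X j + (x + d j)) (c-constant j∈) ⟩
      + X j + (c 1 + d j)               ∎
    c+d≢0 : ∀ {j} → InRange n j → c 1 + d j ≢ 0ℤ
    c+d≢0 {j} j∈ c+d≡0 = X≢Z j∈ (sym (≋⇒≡-InRange (proj₁ LZ j j∈) (proj₁ LX j j∈)
      (≋-trans (Z≋X+c+d j∈) (≋-reflexive (trans (cong (_+_ (+ X j)) c+d≡0) (ℤ.+-identityʳ (+ X j)))))))
    by-c : ∀ {c₁} → Trit c₁ → c 1 ≡ c₁ → ∀ {j} → InRange n j → d j ≡ d 1
    by-c -1ₜ c≡ = Propagation.constant-if-unit LY LZ half -1ℤ 1ℤ 1≉0 d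
      (λ j∈ → trit≢1 (trit-d j∈) (λ d≡1 → c+d≢0 j∈ (cong₂ _+_ c≡ d≡1))) (λ {j} _ → offset-step (Y j) (Z j)) refl 1∈range
    by-c +1ₜ c≡ = Propagation.constant-if-unit LY LZ half 0ℤ 1ℤ 1≉0 d
      (λ j∈ → trit≢-1 (trit-d j∈) (λ d≡-1 → c+d≢0 j∈ (cong₂ _+_ c≡ d≡-1))) (λ {j} _ → offset-step (Y j) (Z j)) refl 1∈range
    by-c 0ₜ c≡ = SignShift.constant LX LZ MX MZ d sign-d Z≋X+d
      where
      sign-d : ∀ {j} → InRange n j → Sign (d j)
      sign-d j∈ =
        [ (λ d≡0 → contradiction (cong₂ _+_ c≡ d≡0) (c+d≢0 j∈)) , (λ sign → sign) ]′ (trit⇒zero⊎sign (trit-d j∈))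
      Z≋X+d : ∀ {j} → InRange n j → + Z j ≋ + X j + d j
      Z≋X+d {j} j∈ = ≋-trans (Z≋X+c+d j∈) (≋-reflexive (cong (λ x → + X j + x) (trans (cong (_+ d j) c≡) (ℤ.+-identityˡ (d j)))))
    d-constant : ∀ {j} → InRange n j → d j ≡ d 1
    d-constant = by-c (trit-c 1∈range) refl

  module LatinSquareRows {L : Square} (LS : LatinSquare n L) (ID : InnerDistanceEq n L (n / 2 ∸ 1)) where

    row-latin : ∀ {i} → InRange n i → LatinRow n (L i)
    row-latin i∈ = (λ j j∈ → proj₁ LS _ j i∈ j∈) , (λ j j' j∈ j'∈ → proj₁ (proj₂ LS) _ j j' i∈ j∈ j'∈)

    row-max : ∀ {i} → InRange n i → MaxInnerDist n (L i)
    row-max i∈ j 1≤j j<n = proj₁ (proj₁ ID) _ j i∈ 1≤j j<n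

    below : ∀ {i} → 1 ≤ i → i < n → ∀ j → InRange n j → bound n ≤ dist n (L i j) (L (suc i) j)
    below 1≤i i<n j j∈ = proj₂ (proj₁ ID) _ j 1≤i i<n j∈

    above : ∀ {i} → 1 ≤ i → i < n → ∀ j → InRange n j → bound n ≤ dist n (L (suc i) j) (L i j)
    above {i} 1≤i i<n j j∈ =
      subst (bound n ≤_) (ℕ.⊓-comm (res n (L i j) (L (suc i) j)) (res n (L (suc i) j) (L i j))) (below 1≤i i<n j j∈)

    SD : ℕ → Set
    SD i = SameDiffs (L i) (L (suc i))

    module _ {i} (1≤i : 1 ≤ i) (i+2≤n : suc (suc i) ≤ n) where
      private
        i∈ : InRange n i
        i∈ = 1≤i , ℕ.≤-trans (ℕ.n≤1+n i) (ℕ.≤-trans (ℕ.n≤1+n (suc i)) i+2≤n)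
        i+1∈ : InRange n (suc i)
        i+1∈ = s≤s z≤n , ℕ.≤-trans (ℕ.n≤1+n (suc i)) i+2≤n
        i+2∈ : InRange n (suc (suc i))
        i+2∈ = s≤s z≤n , i+2≤n
        i<n : i < n
        i<n = ℕ.<-trans (ℕ.n<1+n i) i+2≤n
        columns-differ : ∀ {j} → InRange n j → L i j ≢ L (suc (suc i)) j
        columns-differ j∈ eq = i≢i+2 (proj₂ (proj₂ LS) _ _ _ i∈ i+2∈ j∈ eq)
          where i≢i+2 : i ≢ suc (suc i)
                i≢i+2 ()

      SD-up : SD i → SD (suc i)
      SD-up sd = shifted⇒same-diffs (shift-propagates (row-latin i∈) (row-latin i+1∈) (row-latin i+2∈)
        (row-max i∈) (row-max i+2∈) (below 1≤i i<n) (below (s≤s z≤n) i+2≤n) columns-differ (same-diffs⇒shifted sd))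

      SD-down : SD (suc i) → SD i
      SD-down sd = shifted⇒same-diffs (shifted-sym (shift-propagates (row-latin i+2∈) (row-latin i+1∈) (row-latin i∈)
        (row-max i+2∈) (row-max i∈) (above (s≤s z≤n) i+2≤n) (above 1≤i i<n) (λ j∈ eq → columns-differ j∈ (sym eq))
        (shifted-sym (same-diffs⇒shifted sd))))

    consecutive⇒all : ConsecutiveSameDiff n L → ∀ {k} → 1 ≤ k → k < n → SD k
    consecutive⇒all (i , 1≤i , i<n , sd) {k} 1≤k k<n with ℕ.≤-total i k
    ... | inj₁ i≤k = spread-up SD (λ k i≤k k+2≤n → SD-up (ℕ.≤-trans 1≤i i≤k) k+2≤n) sd i≤k k<n
    ... | inj₂ k≤i = spread-down SD (λ k 1≤k k+1≤i → SD-down 1≤k (ℕ.≤-trans (s≤s k+1≤i) i<n)) sd 1≤k k≤i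

    all⇒row-product : (∀ {k} → 1 ≤ k → k < n → SD k) → RowProduct n L
    all⇒row-product sd i i' j i∈ i'∈ 1≤j j<n = trans (as-first i∈) (sym (as-first i'∈))
      where
      AsFirst : ℕ → Set
      AsFirst i = hdiff n L i j ≡ hdiff n L 1 j
      as-first : ∀ {i} → InRange n i → AsFirst i
      as-first (1≤i , i≤n) = spread-up AsFirst step refl 1≤i (s≤s i≤n)
        where step : ∀ k → 1 ≤ k → suc k < suc n → AsFirst k → AsFirst (suc k)
              step k 1≤k k+1<n+1 eq = trans (sym (sd 1≤k (ℕ.≤-pred k+1<n+1) j 1≤j j<n)) eq

    row-product⇔consecutive : RowProduct n L ⇔ ConsecutiveSameDiff n L
    row-product⇔consecutive = mk⇔
      (λ rp → 1 , ℕ.≤-refl , 1<n , λ j 1≤j j<n → rp 1 2 j 1∈range (s≤s z≤n , 1<n) 1≤j j<n)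
      (λ consecutive → all⇒row-product (consecutive⇒all consecutive))
      where 1<n : 1 < n
            1<n = ℕ.<-trans (s≤s (s≤s z≤n)) 2<n

mainTheorem8 : (n : ℕ) .{{_ : NonZero n}} → 6 ≤ n → 2 ∣ n
    → (∀ (r r' : Row) → Admissible n r → Admissible n r' → Neighbors n r r'
        → ¬ SameRow n (extDiff n r) (extDiff n r')
        → Determined n (extDiff n r) (extDiff n r'))
    × (∀ (L : Square) → LatinSquare n L → InnerDistanceEq n L (n / 2 ∸ 1)
        → (RowProduct n L ⇔ ConsecutiveSameDiff n L))
mainTheorem8 n 6≤n (divides m n≡m*2) =
  (λ r r' → neighbors-determined) , (λ L LS ID → LatinSquareRows.row-product⇔consecutive LS ID)
  where
  n≡m+m : n ≡ m ℕ.+ m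
  n≡m+m = trans n≡m*2 (m*2≡m+m m)
  3≤m : 3 ≤ m
  3≤m = ℕ.*-cancelʳ-≤ 3 m 2 (subst (6 ≤_) n≡m*2 6≤n)
  open EvenOrder n m n≡m+m 3≤m
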